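{- After $M$ moves, a locally-greedy asynchronous collective tree exploration algorithm with targets (with $k$ robots) has explored at least $$\frac{1}{2}\left(M-\sum_{r\in[k]}\sum_{t<M}d(v_t(r),v_{t+1}(r))\right)$$ edges, where $v_t(r)$ denotes the target of robot $r$ at move $t$ and $d$ is the distance in the underlying tree.
   Context: Asynchronous collective tree exploration (ACTE): $k$ robots start at the root of an unknown tree; at each step $t$ an arbitrary (adversarially chosen) robot $r_t\in\{1,\dots,k\}$ is the only one allowed to move, along one adjacent edge; at the beginning of move $t$ the centrally controlled team is only additionally told whether $r_t$ is adjacent to an unexplored edge, and if so can move along it. A locally-greedy ACTE algorithm with targets maintains at all times, for each robot $r$, an already explored node $v_t(r)$ called its target (initially the root, where all robots start), and the $t$-th move is determined by: R1. if robot $r_t$ is adjacent to an unexplored edge, it moves along that edge; R2. otherwise it moves along the adjacent edge leading towards its target $v_t(r_t)$; R3. robot $r_t$ does not stay at its location (so the target is changed beforehand if $r_t$ is at its target and not adjacent to an unexplored edge). -}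

module Defs where

open import Data.Nat using (ℕ; zero; suc; _+_; _≤_; _<_)
open import Data.Fin using (Fin; zero; suc; toℕ)
open import Data.Fin.Properties using (any?; _≟_)
open import Data.Product using (Σ; ∃; _×_; _,_)
open import Data.Sum using (_⊎_)
open import Relation.Binary.PropositionalEquality using (_≡_; _≢_)
open import Relation.Nullary using (¬_; Dec; yes; no)

-- A finite rooted tree on the nodes Fin (suc n); node 0 is the root.
-- Edge e : Fin n joins the non-root node (suc e) to its parent (par e),
-- and parents have strictly smaller labels, which guarantees acyclicity.
-- Every finite rooted tree admits such a labelling (e.g. BFS order).
record Tree : Set where
  field
    n      : ℕ
    par    : Fin n → Fin (suc n)
    par-lt : ∀ e → toℕ (par e) ≤ toℕ e

module _ (T : Tree) where
  open Tree T

  Node : Set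
  Node = Fin (suc n)

  Edge : Set
  Edge = Fin n

  root : Node
  root = zero

  Incident : Edge → Node → Set
  Incident e u = (u ≡ suc e) ⊎ (u ≡ par e)

  Along : Edge → Node → Node → Set
  Along e u w = (u ≡ suc e × w ≡ par e) ⊎ (u ≡ par e × w ≡ suc e)

  Adj : Node → Node → Set
  Adj u w = ∃ λ e → Along e u w

  data Walk : Node → Node → ℕ → Set where
    here : ∀ {u} → Walk u u 0
    step : ∀ {u w v m} → Adj u w → Walk w v m → Walk u v (suc m)

  IsDist : Node → Node → ℕ → Set
  IsDist u v m = Walk u v m × (∀ m′ → Walk u v m′ → m ≤ m′)

∑ : ∀ m → (Fin m → ℕ) → ℕ
∑ zero    f = 0
∑ (suc m) f = f zero + ∑ m (λ i → f (suc i))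

-- An execution of M moves of a locally-greedy ACTE algorithm with targets,
-- with k robots on tree T.
--   rr t      : the robot r_t allowed to move at move t (adversarial, arbitrary)
--   pos t r   : position of robot r before move t   (t = 0 , … , M)
--   edge t    : the edge traversed at move t
--   tgt t r   : target v_t(r) used during move t (chosen at the beginning of move t)
record Execution (T : Tree) (k M : ℕ) : Set where
  open Tree T
  field
    rr   : ℕ → Fin k
    pos  : ℕ → Fin k → Node T
    edge : ℕ → Edge T
    tgt  : ℕ → Fin k → Node T

  Explored : ℕ → Edge T → Set
  Explored t e = ∃ λ (s : Fin t) → edge (toℕ s) ≡ e

  ExploredNode : ℕ → Node T → Set
  ExploredNode t u = (u ≡ root T) ⊎ (∃ λ e → Explored t e × Incident T e u)

  field
    pos-init : ∀ r → pos 0 r ≡ root T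
    tgt-init : ∀ r → tgt 0 r ≡ root T
    tgt-explored : ∀ t r → t ≤ M → ExploredNode t (tgt t r)
    others-stay : ∀ t r → t < M → r ≢ rr t → pos (suc t) r ≡ pos t r
    moves-along : ∀ t → t < M → Along T (edge t) (pos t (rr t)) (pos (suc t) (rr t))
    R1 : ∀ t → t < M →
         (∃ λ e → Incident T e (pos t (rr t)) × ¬ Explored t e) →
         ¬ Explored t (edge t)
    -- R2 + R3: otherwise it moves one step closer to its target v_t(r_t)
    --   (which forces v_t(r_t) ≠ current position)
    R2 : ∀ t → t < M →
         (∀ e → Incident T e (pos t (rr t)) → Explored t e) →
         ∃ λ m → IsDist T (pos (suc t) (rr t)) (tgt t (rr t)) m
               × IsDist T (pos t (rr t)) (tgt t (rr t)) (suc m)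

  explored? : ∀ t e → Dec (Explored t e)
  explored? t e = any? (λ s → edge (toℕ s) ≟ e)

  exploredCount : ℕ → ℕ
  exploredCount t = ∑ n (λ e → indicator (explored? t e))
    where
    indicator : ∀ {P : Set} → Dec P → ℕ
    indicator (yes _) = 1
    indicator (no _)  = 0

{-# OPTIONS --safe #-}
-- Take as potential the total length of some walks from the robots to their targets.
-- Retargeting raises it by at most the target displacement.  A move raises it by at most
-- one more, since the mover can walk back along the edge it traversed, and under R1 that move
-- explores a new edge; under R2 the mover advances along a shortest path, which is no longer
-- than its old walk, so the potential drops by one.  Charging two per explored edge thus pays
-- for every move: t + potential ≤ 2 · explored + displacement.
module Submission where

open import Defs
open import Data.Nat using (ℕ; zero; suc; _+_; _*_; _≤_; _<_; z≤n; s≤s)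
open import Data.Nat.Properties
open import Algebra.Properties.CommutativeMonoid.Sum +-0-commutativeMonoid
  using (sum; sum-init-last) renaming (∑-distrib-+ to sum-distrib-+)
open import Data.Nat.Solver using (module +-*-Solver)
open import Data.Fin using (Fin; toℕ; fromℕ; inject₁) renaming (zero to fzero; suc to fsuc)
open import Data.Fin.Properties using (any?; toℕ-inject₁; toℕ-fromℕ) renaming (_≟_ to _≟ᶠ_; suc-injective to fsuc-injective)
open import Data.Product using (∃; _×_; _,_; proj₁; map₂)
open import Data.Sum using (inj₁; inj₂)
open import Data.Vec.Functional using (_∷_)
open import Data.Empty using (⊥-elim)
open import Function using (_∘_)
open import Relation.Binary.PropositionalEquality
open import Relation.Nullary using (¬_; Dec; yes; no)
open import Relation.Nullary.Decidable using (_×-dec_; _⊎-dec_; ¬?; decidable-stable)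
open import Algebra.Properties.CommutativeSemigroup +-commutativeSemigroup using (xy∙z≈xz∙y)

∑-cong : ∀ m {f g : Fin m → ℕ} → (∀ i → f i ≡ g i) → ∑ m f ≡ ∑ m g
∑-cong zero    f≗g = refl
∑-cong (suc m) f≗g = cong₂ _+_ (f≗g fzero) (∑-cong m (f≗g ∘ fsuc))

∑-mono-≤ : ∀ m {f g : Fin m → ℕ} → (∀ i → f i ≤ g i) → ∑ m f ≤ ∑ m g
∑-mono-≤ zero    f≤g = z≤n
∑-mono-≤ (suc m) f≤g = +-mono-≤ (f≤g fzero) (∑-mono-≤ m (f≤g ∘ fsuc))

∑≡sum : ∀ m (f : Fin m → ℕ) → ∑ m f ≡ sum f
∑≡sum zero    f = refl
∑≡sum (suc m) f = cong (f fzero +_) (∑≡sum m (f ∘ fsuc))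

∑-distrib-+ : ∀ m (f g : Fin m → ℕ) → ∑ m (λ i → f i + g i) ≡ ∑ m f + ∑ m g
∑-distrib-+ m f g = begin
  ∑ m (λ i → f i + g i) ≡⟨ ∑≡sum m _ ⟩
  sum (λ i → f i + g i) ≡⟨ sum-distrib-+ f g ⟩
  sum f + sum g         ≡⟨ sym (cong₂ _+_ (∑≡sum m f) (∑≡sum m g)) ⟩
  ∑ m f + ∑ m g         ∎
  where open ≡-Reasoning

∑-toℕ-suc : ∀ m (f : ℕ → ℕ) → ∑ (suc m) (f ∘ toℕ) ≡ ∑ m (f ∘ toℕ) + f m
∑-toℕ-suc m f = begin
  ∑ (suc m) (f ∘ toℕ)                               ≡⟨ ∑≡sum (suc m) (f ∘ toℕ) ⟩
  sum {suc m} (f ∘ toℕ)                             ≡⟨ sum-init-last (f ∘ toℕ) ⟩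
  sum {m} (f ∘ toℕ ∘ inject₁) + f (toℕ (fromℕ m))   ≡⟨ cong₂ _+_ (sym (∑≡sum m _)) (cong f (toℕ-fromℕ m)) ⟩
  ∑ m (f ∘ toℕ ∘ inject₁) + f m                     ≡⟨ cong (_+ f m) (∑-cong m (cong f ∘ toℕ-inject₁)) ⟩
  ∑ m (f ∘ toℕ) + f m                               ∎
  where open ≡-Reasoning

∑-mono-except : ∀ m {f g : Fin m → ℕ} (j : Fin m) {a b : ℕ} →
                (∀ i → i ≢ j → f i ≤ g i) → f j + a ≤ g j + b → ∑ m f + a ≤ ∑ m g + b
∑-mono-except (suc m) {f} {g} fzero {a} {b} f≤g fj≤gj = begin
  f fzero + ∑ m (f ∘ fsuc) + a   ≡⟨ xy∙z≈xz∙y (f fzero) _ a ⟩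
  f fzero + a + ∑ m (f ∘ fsuc)   ≤⟨ +-mono-≤ fj≤gj (∑-mono-≤ m (λ i → f≤g (fsuc i) λ ())) ⟩
  g fzero + b + ∑ m (g ∘ fsuc)   ≡⟨ xy∙z≈xz∙y (g fzero) _ b ⟨
  g fzero + ∑ m (g ∘ fsuc) + b   ∎
  where open ≤-Reasoning
∑-mono-except (suc m) {f} {g} (fsuc j) {a} {b} f≤g fj≤gj = begin
  f fzero + ∑ m (f ∘ fsuc) + a     ≡⟨ +-assoc (f fzero) _ a ⟩
  f fzero + (∑ m (f ∘ fsuc) + a)   ≤⟨ +-mono-≤ (f≤g fzero λ ()) (∑-mono-except m j f≤g-tail fj≤gj) ⟩
  g fzero + (∑ m (g ∘ fsuc) + b)   ≡⟨ +-assoc (g fzero) _ b ⟨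
  g fzero + ∑ m (g ∘ fsuc) + b     ∎
  where
  open ≤-Reasoning
  f≤g-tail : ∀ i → i ≢ j → f (fsuc i) ≤ g (fsuc i)
  f≤g-tail i i≢j = f≤g (fsuc i) (i≢j ∘ fsuc-injective)

∑-replace : ∀ m (Q : Fin m → ℕ → Set) (j : Fin m) (g : Fin m → ℕ) {L a b : ℕ} →
            (∀ i → i ≢ j → Q i (g i)) → Q j L → L + a ≤ g j + b →
            ∃ λ f → (∀ i → Q i (f i)) × ∑ m f + a ≤ ∑ m g + b
∑-replace (suc m) Q fzero g {L} Qg QL L≤gj =
  (L ∷ g ∘ fsuc) , Q-replaced , ∑-mono-except (suc m) fzero replaced≤g L≤gj
  where
  Q-replaced : ∀ i → Q i ((L ∷ g ∘ fsuc) i)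
  Q-replaced fzero    = QL
  Q-replaced (fsuc i) = Qg (fsuc i) λ ()

  replaced≤g : ∀ i → i ≢ fzero → (L ∷ g ∘ fsuc) i ≤ g i
  replaced≤g fzero    i≢0 = ⊥-elim (i≢0 refl)
  replaced≤g (fsuc i) _   = ≤-refl
∑-replace (suc m) Q (fsuc j) g {a = a} {b} Qg QL L≤gj
  with ∑-replace m (Q ∘ fsuc) j (g ∘ fsuc) (λ i i≢j → Qg (fsuc i) (i≢j ∘ fsuc-injective)) QL L≤gj
... | f , Qf , ∑f≤∑g = (g fzero ∷ f) , Q-replaced , bound
  where
  Q-replaced : ∀ i → Q i ((g fzero ∷ f) i)
  Q-replaced fzero    = Qg fzero λ ()
  Q-replaced (fsuc i) = Qf i

  bound : g fzero + ∑ m f + a ≤ g fzero + ∑ m (g ∘ fsuc) + b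
  bound = begin
    g fzero + ∑ m f + a              ≡⟨ +-assoc (g fzero) _ a ⟩
    g fzero + (∑ m f + a)            ≤⟨ +-monoʳ-≤ (g fzero) ∑f≤∑g ⟩
    g fzero + (∑ m (g ∘ fsuc) + b)   ≡⟨ +-assoc (g fzero) _ b ⟨
    g fzero + ∑ m (g ∘ fsuc) + b     ∎
    where open ≤-Reasoning

explore-amortized : ∀ {x y e e′} → x ≤ suc y → suc e ≤ e′ → suc x + 2 * e ≤ y + 2 * e′
explore-amortized {x} {y} {e} {e′} x≤1+y 1+e≤e′ = begin
  suc x + 2 * e             ≤⟨ +-monoˡ-≤ (2 * e) (s≤s x≤1+y) ⟩
  suc (suc y) + 2 * e       ≡⟨ solve 2 (λ y e → con 2 :+ y :+ con 2 :* e := y :+ con 2 :* (con 1 :+ e)) refl y e ⟩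
  y + 2 * suc e             ≤⟨ +-monoʳ-≤ y (*-monoʳ-≤ 2 1+e≤e′) ⟩
  y + 2 * e′                ∎
  where open ≤-Reasoning; open +-*-Solver

amortized-telescope : ∀ {t p p′ c d e e′} → t + p ≤ e + c → suc p′ + e ≤ p + d + e′ →
                      suc t + p′ ≤ e′ + (c + d)
amortized-telescope {t} {p} {p′} {c} {d} {e} {e′} before gain = +-cancelʳ-≤ e _ _ (begin
  suc t + p′ + e        ≡⟨ solve 3 (λ t p′ e → con 1 :+ t :+ p′ :+ e := t :+ (con 1 :+ p′ :+ e)) refl t p′ e ⟩
  t + (suc p′ + e)      ≤⟨ +-monoʳ-≤ t gain ⟩
  t + (p + d + e′)      ≡⟨ solve 4 (λ t p d e′ → t :+ (p :+ d :+ e′) := t :+ p :+ (d :+ e′)) refl t p d e′ ⟩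
  t + p + (d + e′)      ≤⟨ +-monoˡ-≤ (d + e′) before ⟩
  e + c + (d + e′)      ≡⟨ solve 4 (λ e c d e′ → e :+ c :+ (d :+ e′) := e′ :+ (c :+ d) :+ e) refl e c d e′ ⟩
  e′ + (c + d) + e      ∎)
  where open ≤-Reasoning; open +-*-Solver

indicator : ∀ {P : Set} → Dec P → ℕ
indicator (yes _) = 1
indicator (no _)  = 0

indicator-mono : ∀ {P Q : Set} (P? : Dec P) (Q? : Dec Q) → (P → Q) → indicator P? ≤ indicator Q?
indicator-mono (yes _) (yes _) _   = ≤-refl
indicator-mono (yes p) (no ¬q) P⇒Q = ⊥-elim (¬q (P⇒Q p))
indicator-mono (no _)  _       _   = z≤n

indicator-gain : ∀ {P Q : Set} (P? : Dec P) (Q? : Dec Q) → ¬ P → Q → indicator P? + 1 ≤ indicator Q? + 0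
indicator-gain (yes p) _       ¬p _ = ⊥-elim (¬p p)
indicator-gain (no _)  (yes _) _  _ = ≤-refl
indicator-gain (no _)  (no ¬q) _  q = ⊥-elim (¬q q)

_++ʷ_ : ∀ {T u v w m m′} → Walk T u v m → Walk T v w m′ → Walk T u w (m + m′)
here      ++ʷ q = q
step uw p ++ʷ q = step uw (p ++ʷ q)

Along-sym : ∀ T {e u w} → Along T e u w → Along T e w u
Along-sym _ (inj₁ (u≡ , w≡)) = inj₂ (w≡ , u≡)
Along-sym _ (inj₂ (u≡ , w≡)) = inj₁ (w≡ , u≡)

module _ {T : Tree} {k M : ℕ} (E : Execution T k M) where
  open Tree T
  open Execution E

  Explored-suc : ∀ {t e} → Explored t e → Explored (suc t) e
  Explored-suc (s , refl) = inject₁ s , cong edge (toℕ-inject₁ s)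

  Explored-edge : ∀ t → Explored (suc t) (edge t)
  Explored-edge t = fromℕ t , cong edge (toℕ-fromℕ t)

  -- The indicator used by exploredCount is local to its definition, so it is left to unification;
  -- the clauses come after the use that determines it.
  explored-indicator : ∀ t e → _ ≡ indicator (explored? t e)

  exploredCount≡∑indicator : ∀ t → exploredCount t ≡ ∑ n (λ e → indicator (explored? t e))
  exploredCount≡∑indicator t = ∑-cong n (explored-indicator t)

  explored-indicator t e with explored? t e
  ... | yes _ = refl
  ... | no _  = refl

  exploredCount-mono : ∀ t → exploredCount t ≤ exploredCount (suc t)
  exploredCount-mono t =
    subst₂ _≤_ (sym (exploredCount≡∑indicator t)) (sym (exploredCount≡∑indicator (suc t)))
      (∑-mono-≤ n λ e → indicator-mono (explored? t e) (explored? (suc t) e) Explored-suc)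

  exploredCount-new : ∀ t → ¬ Explored t (edge t) → suc (exploredCount t) ≤ exploredCount (suc t)
  exploredCount-new t unexplored =
    subst₂ _≤_ (trans (+-comm _ 1) (cong suc (sym (exploredCount≡∑indicator t))))
               (trans (+-identityʳ _) (sym (exploredCount≡∑indicator (suc t))))
      (∑-mono-except n (edge t)
        (λ e _ → indicator-mono (explored? t e) (explored? (suc t) e) Explored-suc)
        (indicator-gain (explored? t (edge t)) (explored? (suc t) (edge t)) unexplored (Explored-edge t)))

  Frontier : ℕ → Node T → Set
  Frontier t u = ∃ λ e → Incident T e u × ¬ Explored t e

  frontier? : ∀ t u → Dec (Frontier t u)
  frontier? t u = any? λ e → ((u ≟ᶠ fsuc e) ⊎-dec (u ≟ᶠ par e)) ×-dec ¬? (explored? t e)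

  module _ (D : Fin k → ℕ → ℕ)
           (D-dist : ∀ r t → t < M → IsDist T (tgt t r) (tgt (suc t) r) (D r t)) where

    WalksToTargets : ℕ → (Fin k → ℕ) → Set
    WalksToTargets t ℓ = ∀ r → Walk T (pos t r) (tgt t r) (ℓ r)

    drift : ℕ → ℕ
    drift t = ∑ k (λ r → D r t)

    totalDrift : ℕ → ℕ
    totalDrift t = ∑ k (λ r → ∑ t (λ s → D r (toℕ s)))

    totalDrift-suc : ∀ t → totalDrift (suc t) ≡ totalDrift t + drift t
    totalDrift-suc t = trans (∑-cong k λ r → ∑-toℕ-suc t (D r)) (∑-distrib-+ k _ _)

    retarget : ∀ {t r u m} → t < M → Walk T u (tgt t r) m → Walk T u (tgt (suc t) r) (m + D r t)
    retarget {t} {r} t<M w = w ++ʷ proj₁ (D-dist r t t<M)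

    idle-walk : ∀ {t ℓ} → t < M → WalksToTargets t ℓ →
                ∀ r → r ≢ rr t → Walk T (pos (suc t) r) (tgt (suc t) r) (ℓ r + D r t)
    idle-walk {t} t<M W r r≢rₜ =
      retarget t<M (subst (λ u → Walk T u (tgt t r) _) (sym (others-stay t r t<M r≢rₜ)) (W r))

    any-move-step : ∀ {t ℓ} → t < M → WalksToTargets t ℓ →
                    ∃ λ ℓ′ → WalksToTargets (suc t) ℓ′ × ∑ k ℓ′ ≤ suc (∑ k ℓ + drift t)
    any-move-step {t} {ℓ} t<M W
      with ∑-replace k (λ r → Walk T (pos (suc t) r) (tgt (suc t) r)) (rr t) (λ r → ℓ r + D r t)
             (idle-walk t<M W) back-and-retarget (≤-reflexive (trans (+-identityʳ _) (+-comm 1 _)))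
      where
      back-and-retarget : Walk T (pos (suc t) (rr t)) (tgt (suc t) (rr t)) (suc (ℓ (rr t)) + D (rr t) t)
      back-and-retarget = retarget t<M (step (edge t , Along-sym T (moves-along t t<M)) (W (rr t)))
    ... | ℓ′ , W′ , bound =
      ℓ′ , W′ , subst₂ _≤_ (+-identityʳ _) (trans (+-comm _ 1) (cong suc (∑-distrib-+ k ℓ _))) bound

    approach-step : ∀ {t ℓ} → t < M → ¬ Frontier t (pos t (rr t)) →
                    WalksToTargets t ℓ →
                    ∃ λ ℓ′ → WalksToTargets (suc t) ℓ′ × suc (∑ k ℓ′) ≤ ∑ k ℓ + drift t
    approach-step {t} {ℓ} t<M no-frontier W
      with R2 t t<M (λ e inc → decidable-stable (explored? t e) (λ ¬ex → no-frontier (e , inc , ¬ex)))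
    ... | m , (w , _) , (_ , shortest)
      with ∑-replace k (λ r → Walk T (pos (suc t) r) (tgt (suc t) r)) (rr t) (λ r → ℓ r + D r t)
             (idle-walk t<M W) (retarget t<M w)
             (≤-trans (≤-reflexive (+-comm _ 1))
               (≤-trans (+-monoˡ-≤ (D (rr t) t) (shortest (ℓ (rr t)) (W (rr t))))
                 (≤-reflexive (sym (+-identityʳ _)))))
    ... | ℓ′ , W′ , bound =
      ℓ′ , W′ , subst₂ _≤_ (+-comm _ 1) (trans (+-identityʳ _) (∑-distrib-+ k ℓ _)) bound

    amortized-step : ∀ {t ℓ} → t < M → WalksToTargets t ℓ →
                     ∃ λ ℓ′ → WalksToTargets (suc t) ℓ′ ×
                              suc (∑ k ℓ′) + 2 * exploredCount t ≤ ∑ k ℓ + drift t + 2 * exploredCount (suc t)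
    amortized-step {t} t<M W with frontier? t (pos t (rr t))
    ... | yes frontier =
      map₂ (map₂ λ ∑ℓ′≤ → explore-amortized ∑ℓ′≤ (exploredCount-new t (R1 t t<M frontier)))
           (any-move-step t<M W)
    ... | no no-frontier =
      map₂ (map₂ λ suc∑ℓ′≤ → +-mono-≤ suc∑ℓ′≤ (*-monoʳ-≤ 2 (exploredCount-mono t)))
           (approach-step t<M no-frontier W)

    potential-invariant : ∀ t → t ≤ M →
                          ∃ λ ℓ → WalksToTargets t ℓ × t + ∑ k ℓ ≤ 2 * exploredCount t + totalDrift t
    potential-invariant zero _ = (λ _ → 0) , start , m≤n+m _ _
      where
      start : WalksToTargets 0 (λ _ → 0)
      start r = subst₂ (λ u v → Walk T u v 0) (sym (pos-init r)) (sym (tgt-init r)) here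
    potential-invariant (suc t) t<M with potential-invariant t (<⇒≤ t<M)
    ... | ℓ , W , bound =
      map₂ (map₂ λ gain → ≤-trans (amortized-telescope {t} {e = 2 * exploredCount t} bound gain)
                                   (≤-reflexive (cong (2 * exploredCount (suc t) +_) (sym (totalDrift-suc t)))))
           (amortized-step t<M W)

proposition3p8 :
    (T : Tree) (k M : ℕ) (E : Execution T k M) →
    (D : Fin k → ℕ → ℕ) →
    (∀ r t → t < M →
      IsDist T (Execution.tgt E t r) (Execution.tgt E (suc t) r) (D r t)) →
    M ≤ 2 * Execution.exploredCount E M + ∑ k (λ r → ∑ M (λ t → D r (toℕ t)))
proposition3p8 T k M E D D-dist with potential-invariant E D D-dist M ≤-refl
... | _ , _ , bound = ≤-trans (m≤m+n M _) bound
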